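{- Let $G=(V,E)$ be a simple graph with $n=|V|$ vertices, and let $\tilde F=\min\{F(x): x\in\tilde D\}$. Then: (i) if $\tilde F=0$, then $G$ has a Hamiltonian circuit; (ii) if $\tilde F\ge 1/n!$, then $G$ does not have a Hamiltonian circuit.
   Context: Variables are $x=(x^i_v)$ with $i\in\{0,1,\dots,n-1\}$, $v\in V$, so $x\in\mathbb{R}^{n^2}$. Let $\overline{E}(G)=V^2\setminus E(G)$, i.e. the set of pairs $(v,u)\in V\times V$ with $\{v,u\}\notin E(G)$. Define $F(x)=\sum_{i=0}^{n-1}\sum_{(v,u)\in\overline{E}(G)} x^i_v\, x^{(i+1)\%n}_u$, where $a\%b$ is the remainder of $a$ modulo $b$. Let $D_1=\{x:\sum_{v\in V}x^i_v=1 \text{ for } i=0,\dots,n-1\}$, $D_2=\{x:\sum_{i=0}^{n-1}x^i_v=1 \text{ for } v\in V\}$, and $\tilde D=D_1\cap D_2\cap[0,1]^{n^2}$. A Hamiltonian circuit of $G$ is a cyclic ordering $\langle v_0,\dots,v_{n-1}\rangle$ of all vertices with $\{v_i,v_{(i+1)\%n}\}\in E$ for all $i$.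
   Formalization: The points x have rational rather than real coordinates, and $\tilde F$ is a rational number that is the minimum of F over the rational points of $\tilde D$. -}

module Defs where

open import Data.Nat using (ℕ; zero; suc; _!)
open import Data.Nat.DivMod using (_%_; m%n<n)
open import Data.Nat.Properties using (_!≢0)
open import Data.Fin using (Fin; toℕ; fromℕ<)
open import Data.Fin.Permutation using (Permutation′; _⟨$⟩ʳ_)
open import Data.Bool using (Bool; true; false; if_then_else_)
open import Data.Integer using (+_)
open import Data.Rational using (ℚ; 0ℚ; 1ℚ; _+_; _*_; _≤_) renaming (_/_ to _÷ℚ_)
open import Data.Product using (Σ; _×_)
open import Relation.Binary.PropositionalEquality using (_≡_)

record SimpleGraph (n : ℕ) : Set where
  field
    adj   : Fin n → Fin n → Bool
    sym   : ∀ u v → adj u v ≡ adj v u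
    irrefl : ∀ v → adj v v ≡ false
open SimpleGraph public

next : {n : ℕ} → Fin n → Fin n
next {suc m} i = fromℕ< (m%n<n (suc (toℕ i)) (suc m))

sumFin : (n : ℕ) → (Fin n → ℚ) → ℚ
sumFin zero    f = 0ℚ
sumFin (suc n) f = f Fin.zero + sumFin n (λ i → f (Fin.suc i))
  where import Data.Fin as Fin

-- Points x = (x^i_v), i, v ∈ Fin n, written x i v.
Point : ℕ → Set
Point n = Fin n → Fin n → ℚ

-- F(x) = Σ_i Σ_{(v,u) ∈ V² \ E} x^i_v x^{(i+1)%n}_u.
-- (v,u) ∈ V² \ E iff {v,u} ∉ E, i.e. adj v u = false (includes v = u).
F : {n : ℕ} → SimpleGraph n → Point n → ℚ
F {n} G x =
  sumFin n λ i → sumFin n λ v → sumFin n λ u →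
    (if adj G v u then 0ℚ else x i v * x (next i) u)

InD̃ : {n : ℕ} → Point n → Set
InD̃ {n} x =
  (∀ i → sumFin n (λ v → x i v) ≡ 1ℚ) ×
  (∀ v → sumFin n (λ i → x i v) ≡ 1ℚ) ×
  (∀ i v → (0ℚ ≤ x i v) × (x i v ≤ 1ℚ))

IsMinF : {n : ℕ} → SimpleGraph n → ℚ → Set
IsMinF {n} G m =
  Σ (Point n) (λ x → InD̃ x × F G x ≡ m) × (∀ x → InD̃ x → m ≤ F G x)

HamiltonianCircuit : {n : ℕ} → SimpleGraph n → Set
HamiltonianCircuit {n} G =
  Σ (Permutation′ n) λ σ → ∀ i → adj G (σ ⟨$⟩ʳ i) (σ ⟨$⟩ʳ next i) ≡ true

1/n! : ℕ → ℚ
1/n! n = ((+ 1) ÷ℚ (n !)) {{n !≢0}}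

{-# OPTIONS --safe #-}
-- If F̃ = 0, the minimiser x is doubly stochastic and every product x^i_v x^{i+1}_u with
-- {v,u} ∉ E vanishes. A doubly stochastic matrix has a positive diagonal x^i_{σ i} > 0
-- (Birkhoff–König), and then each {σ i, σ (i+1)} is an edge, so σ is a Hamiltonian circuit.
-- The diagonal comes from Hall's theorem: rows S carry total mass |S|, all of it inside the
-- columns N(S), which carry total mass |N(S)|; a matching is grown row by row along augmenting
-- paths, and when the search for one gets stuck the visited rows form a set violating Hall.
-- Conversely the permutation matrix of a Hamiltonian circuit lies in D̃ and has F = 0, so
-- F̃ ≤ 0 < 1/n!.
module Submission where

open import Defs
open import Data.Nat using (ℕ)
open import Data.Product using (_×_)
open import Data.Rational using (ℚ; 0ℚ; _≤_)
open import Relation.Nullary using (¬_)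
open import Relation.Binary.PropositionalEquality using (_≡_)

open import Algebra.Bundles using (Ring)
import Algebra.Properties.Semiring.Sum as SemiringSum
open import Data.Bool using (true; false; if_then_else_)
open import Data.Empty using (⊥-elim)
open import Data.Fin using (Fin; zero; suc; toℕ; fromℕ<; punchIn)
open import Data.Fin.Properties using (_≟_; any?; punchInᵢ≢i; toℕ-injective; toℕ-fromℕ<; toℕ<n)
open import Data.Fin.Permutation using (Permutation′; _⟨$⟩ʳ_; _∘ₚ_)
import Data.Fin.Permutation as Perm
open import Data.List using (List; length; filter; allFin)
open import Data.List.Properties using (filter-notAll)
open import Data.List.Membership.Propositional using (_∈_; _∉_)
open import Data.List.Membership.Propositional.Properties using (∈-allFin; ∈-filter⁺; ∈-filter⁻)
import Data.List.Relation.Unary.Any as Any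
import Data.Nat as ℕ
open import Data.Nat using (_!)
open import Data.Nat.Induction using (<-wellFounded)
open import Data.Nat.Properties using (_!≢0)
import Data.Nat.Properties as ℕ
open import Data.Product using (Σ; ∃; _,_; proj₁; proj₂)
open import Data.Rational using (1ℚ; _+_; _*_; _<_; positive; nonNegative)
import Data.Rational.Properties as ℚ
open import Data.Sum using (_⊎_; inj₁; inj₂)
open import Data.Unit using (⊤; tt)
open import Function using (_∘_; id)
open import Induction.WellFounded using (Acc; acc)
open import Level using (0ℓ)
open import Relation.Binary.PropositionalEquality using (refl; trans; cong; cong₂; _≢_; ≢-sym; module ≡-Reasoning)
import Relation.Binary.PropositionalEquality as ≡
open import Relation.Nullary using (Dec; yes; no; does)
open import Relation.Nullary.Decidable using (dec-true; dec-false; _×-dec_; _⊎-dec_; ¬?; decidable-stable)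
open import Relation.Unary using (Pred; Decidable)

*-nonNeg : ∀ {p q} → 0ℚ ≤ p → 0ℚ ≤ q → 0ℚ ≤ p * q
*-nonNeg {p} {q} p≥0 q≥0 =
  ℚ.nonNegative⁻¹ _ {{ℚ.nonNeg*nonNeg⇒nonNeg p {{nonNegative p≥0}} q {{nonNegative q≥0}}}}

*-pos : ∀ {p q} → 0ℚ < p → 0ℚ < q → 0ℚ < p * q
*-pos {p} {q} p>0 q>0 = ℚ.positive⁻¹ _ {{ℚ.pos*pos⇒pos p {{positive p>0}} q {{positive q>0}}}}

p<1+p : ∀ p → p < 1ℚ + p
p<1+p p = begin-strict
  p        ≡⟨ ≡.sym (ℚ.+-identityˡ p) ⟩
  0ℚ + p   <⟨ ℚ.+-monoˡ-< p (ℚ.positive⁻¹ 1ℚ) ⟩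
  1ℚ + p   ∎
  where open ℚ.≤-Reasoning

1/n!-pos : ∀ n → 0ℚ < 1/n! n
1/n!-pos n = ℚ.positive⁻¹ (1/n! n) {{ℚ.normalize-pos 1 (n !) {{n !≢0}}}}

module Sum = SemiringSum (Ring.semiring ℚ.+-*-ring)

sumFin≗sum : ∀ n (f : Fin n → ℚ) → sumFin n f ≡ Sum.sum f
sumFin≗sum ℕ.zero    f = refl
sumFin≗sum (ℕ.suc n) f = cong (f zero +_) (sumFin≗sum n (f ∘ suc))

sumFin-cong : ∀ n {f g : Fin n → ℚ} → (∀ i → f i ≡ g i) → sumFin n f ≡ sumFin n g
sumFin-cong n {f} {g} f≗g = begin
  sumFin n f  ≡⟨ sumFin≗sum n f ⟩
  Sum.sum f   ≡⟨ Sum.sum-cong-≗ f≗g ⟩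
  Sum.sum g   ≡⟨ ≡.sym (sumFin≗sum n g) ⟩
  sumFin n g  ∎
  where open ≡-Reasoning

sumFin-mono-≤ : ∀ n {f g : Fin n → ℚ} → (∀ i → f i ≤ g i) → sumFin n f ≤ sumFin n g
sumFin-mono-≤ ℕ.zero    f≤g = ℚ.≤-refl
sumFin-mono-≤ (ℕ.suc n) f≤g = ℚ.+-mono-≤ (f≤g zero) (sumFin-mono-≤ n (f≤g ∘ suc))

sumFin-zero : ∀ n {f : Fin n → ℚ} → (∀ i → f i ≡ 0ℚ) → sumFin n f ≡ 0ℚ
sumFin-zero ℕ.zero    f≡0 = refl
sumFin-zero (ℕ.suc n) f≡0 = cong₂ _+_ (f≡0 zero) (sumFin-zero n (f≡0 ∘ suc))

sumFin-nonNeg : ∀ n {f : Fin n → ℚ} → (∀ i → 0ℚ ≤ f i) → 0ℚ ≤ sumFin n f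
sumFin-nonNeg ℕ.zero    f≥0 = ℚ.≤-refl
sumFin-nonNeg (ℕ.suc n) f≥0 = ℚ.+-mono-≤ (f≥0 zero) (sumFin-nonNeg n (f≥0 ∘ suc))

sumFin-remove : ∀ n (f : Fin (ℕ.suc n) → ℚ) i → sumFin (ℕ.suc n) f ≡ f i + sumFin n (f ∘ punchIn i)
sumFin-remove n f i = begin
  sumFin (ℕ.suc n) f                 ≡⟨ sumFin≗sum (ℕ.suc n) f ⟩
  Sum.sum f                          ≡⟨ Sum.sum-remove f ⟩
  f i + Sum.sum (f ∘ punchIn i)      ≡⟨ cong (f i +_) (≡.sym (sumFin≗sum n (f ∘ punchIn i))) ⟩
  f i + sumFin n (f ∘ punchIn i)     ∎
  where open ≡-Reasoning

term≤sumFin : ∀ n {f : Fin n → ℚ} → (∀ i → 0ℚ ≤ f i) → ∀ i → f i ≤ sumFin n f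
term≤sumFin (ℕ.suc n) {f} f≥0 i = begin
  f i                              ≡⟨ ≡.sym (ℚ.+-identityʳ (f i)) ⟩
  f i + 0ℚ                         ≤⟨ ℚ.+-monoʳ-≤ (f i) (sumFin-nonNeg n (f≥0 ∘ punchIn i)) ⟩
  f i + sumFin n (f ∘ punchIn i)   ≡⟨ ≡.sym (sumFin-remove n f i) ⟩
  sumFin (ℕ.suc n) f               ∎
  where open ℚ.≤-Reasoning

sumFin≡0⇒term≡0 : ∀ n {f : Fin n → ℚ} → (∀ i → 0ℚ ≤ f i) → sumFin n f ≡ 0ℚ → ∀ i → f i ≡ 0ℚ
sumFin≡0⇒term≡0 n f≥0 Σf≡0 i =
  ℚ.≤-antisym (ℚ.≤-trans (term≤sumFin n f≥0 i) (ℚ.≤-reflexive Σf≡0)) (f≥0 i)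

sumFin-single : ∀ n {f : Fin n → ℚ} a → (∀ i → i ≢ a → f i ≡ 0ℚ) → sumFin n f ≡ f a
sumFin-single (ℕ.suc n) {f} a f≡0 = begin
  sumFin (ℕ.suc n) f               ≡⟨ sumFin-remove n f a ⟩
  f a + sumFin n (f ∘ punchIn a)   ≡⟨ cong (f a +_) (sumFin-zero n (λ i → f≡0 (punchIn a i) (punchInᵢ≢i a i))) ⟩
  f a + 0ℚ                         ≡⟨ ℚ.+-identityʳ (f a) ⟩
  f a                              ∎
  where open ≡-Reasoning

sumFin-permute : ∀ n (f : Fin n → ℚ) (π : Permutation′ n) → sumFin n (f ∘ (π ⟨$⟩ʳ_)) ≡ sumFin n f
sumFin-permute n f π = begin
  sumFin n (f ∘ (π ⟨$⟩ʳ_))   ≡⟨ sumFin≗sum n _ ⟩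
  Sum.sum (f ∘ (π ⟨$⟩ʳ_))    ≡⟨ ≡.sym (Sum.sum-permute f π) ⟩
  Sum.sum f                  ≡⟨ ≡.sym (sumFin≗sum n f) ⟩
  sumFin n f                 ∎
  where open ≡-Reasoning

sumFin-distrib-+ : ∀ n (f g : Fin n → ℚ) → sumFin n (λ i → f i + g i) ≡ sumFin n f + sumFin n g
sumFin-distrib-+ n f g = begin
  sumFin n (λ i → f i + g i)    ≡⟨ sumFin≗sum n _ ⟩
  Sum.sum (λ i → f i + g i)     ≡⟨ Sum.∑-distrib-+ f g ⟩
  Sum.sum f + Sum.sum g         ≡⟨ cong₂ _+_ (≡.sym (sumFin≗sum n f)) (≡.sym (sumFin≗sum n g)) ⟩
  sumFin n f + sumFin n g       ∎
  where open ≡-Reasoning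

*-distribˡ-sumFin : ∀ n c (f : Fin n → ℚ) → c * sumFin n f ≡ sumFin n (λ i → c * f i)
*-distribˡ-sumFin n c f = begin
  c * sumFin n f             ≡⟨ cong (c *_) (sumFin≗sum n f) ⟩
  c * Sum.sum f              ≡⟨ Sum.*-distribˡ-sum c f ⟩
  Sum.sum (λ i → c * f i)    ≡⟨ ≡.sym (sumFin≗sum n _) ⟩
  sumFin n (λ i → c * f i)   ∎
  where open ≡-Reasoning

sumFin-comm : ∀ m n (f : Fin m → Fin n → ℚ) →
  sumFin m (λ i → sumFin n (f i)) ≡ sumFin n (λ j → sumFin m (λ i → f i j))
sumFin-comm m n f = begin
  sumFin m (λ i → sumFin n (f i))             ≡⟨ sumFin²≗sum² m n f ⟩
  Sum.sum (λ i → Sum.sum (f i))               ≡⟨ Sum.∑-comm f ⟩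
  Sum.sum (λ j → Sum.sum (λ i → f i j))       ≡⟨ ≡.sym (sumFin²≗sum² n m (λ j i → f i j)) ⟩
  sumFin n (λ j → sumFin m (λ i → f i j))     ∎
  where
  open ≡-Reasoning
  sumFin²≗sum² : ∀ m n (g : Fin m → Fin n → ℚ) →
    sumFin m (λ i → sumFin n (g i)) ≡ Sum.sum (λ i → Sum.sum (g i))
  sumFin²≗sum² m n g = trans (sumFin≗sum m _) (Sum.sum-cong-≗ (λ i → sumFin≗sum n (g i)))

𝟙 : {P : Set} → Dec P → ℚ
𝟙 P? = if does P? then 1ℚ else 0ℚ

module _ {P : Set} (P? : Dec P) where

  𝟙-yes : P → 𝟙 P? ≡ 1ℚ
  𝟙-yes p = cong (λ b → if b then 1ℚ else 0ℚ) (dec-true P? p)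

  𝟙-no : ¬ P → 𝟙 P? ≡ 0ℚ
  𝟙-no ¬p = cong (λ b → if b then 1ℚ else 0ℚ) (dec-false P? ¬p)

0≤𝟙 : {P : Set} (P? : Dec P) → 0ℚ ≤ 𝟙 P?
0≤𝟙 (yes _) = ℚ.nonNegative⁻¹ 1ℚ
0≤𝟙 (no _)  = ℚ.≤-refl

𝟙≤1 : {P : Set} (P? : Dec P) → 𝟙 P? ≤ 1ℚ
𝟙≤1 (yes _) = ℚ.≤-refl
𝟙≤1 (no _)  = ℚ.nonNegative⁻¹ 1ℚ

card : ∀ {n} {S : Pred (Fin n) 0ℓ} → Decidable S → ℚ
card {n} S? = sumFin n (λ i → 𝟙 (S? i))

card-singleton : ∀ {n} {S : Pred (Fin n) 0ℓ} (S? : Decidable S) {a} → S a → (∀ {i} → S i → i ≡ a) →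
  card S? ≡ 1ℚ
card-singleton {n} S? {a} Sa S⊆a = begin
  card S?       ≡⟨ sumFin-single n a (λ i i≢a → 𝟙-no (S? i) (i≢a ∘ S⊆a)) ⟩
  𝟙 (S? a)      ≡⟨ 𝟙-yes (S? a) Sa ⟩
  1ℚ            ∎
  where open ≡-Reasoning

record DoublyStochastic {n : ℕ} (M : Fin n → Fin n → ℚ) : Set where
  field
    nonNeg : ∀ i v → 0ℚ ≤ M i v
    rowSum : ∀ i → sumFin n (λ v → M i v) ≡ 1ℚ
    colSum : ∀ v → sumFin n (λ i → M i v) ≡ 1ℚ

permuteColumns : ∀ {n} {M : Fin n → Fin n → ℚ} → DoublyStochastic M → (π : Permutation′ n) →
  DoublyStochastic (λ i c → M i (π ⟨$⟩ʳ c))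
permuteColumns {n} {M} ds π = record
  { nonNeg = λ i c → nonNeg i (π ⟨$⟩ʳ c)
  ; rowSum = λ i → trans (sumFin-permute n (M i) π) (rowSum i)
  ; colSum = λ c → colSum (π ⟨$⟩ʳ c)
  }
  where open DoublyStochastic ds

-- Witnesses |R[S]| < |S| without counting: j ∈ S but R[S] ⊆ S ∖ {j}.
Deficient : ∀ {n} → (Fin n → Fin n → Set) → Pred (Fin n) 0ℓ → Fin n → Set
Deficient R S j = S j × (∀ u c → S u → R u c → S c × c ≢ j)

module _ {n : ℕ} {M : Fin n → Fin n → ℚ} (ds : DoublyStochastic M) where
  open DoublyStochastic ds

  support⊆⇒card≤card : ∀ {S T : Pred (Fin n) 0ℓ} (S? : Decidable S) (T? : Decidable T) →
    (∀ u c → S u → 0ℚ < M u c → T c) → card S? ≤ card T?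
  support⊆⇒card≤card S? T? S→T = begin
    card S?
      ≡⟨ sumFin-cong n (λ u → ≡.sym (times-sum≡1 (rowSum u))) ⟩
    sumFin n (λ u → 𝟙 (S? u) * sumFin n (λ c → M u c))
      ≡⟨ sumFin-cong n (λ u → *-distribˡ-sumFin n (𝟙 (S? u)) (M u)) ⟩
    sumFin n (λ u → sumFin n (λ c → 𝟙 (S? u) * M u c))
      ≤⟨ sumFin-mono-≤ n (λ u → sumFin-mono-≤ n (weight≤ u)) ⟩
    sumFin n (λ u → sumFin n (λ c → 𝟙 (T? c) * M u c))
      ≡⟨ sumFin-comm n n _ ⟩
    sumFin n (λ c → sumFin n (λ u → 𝟙 (T? c) * M u c))
      ≡⟨ sumFin-cong n (λ c → ≡.sym (*-distribˡ-sumFin n (𝟙 (T? c)) (λ u → M u c))) ⟩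
    sumFin n (λ c → 𝟙 (T? c) * sumFin n (λ u → M u c))
      ≡⟨ sumFin-cong n (λ c → times-sum≡1 (colSum c)) ⟩
    card T? ∎
    where
    open ℚ.≤-Reasoning
    times-sum≡1 : ∀ {a s} → s ≡ 1ℚ → a * s ≡ a
    times-sum≡1 {a} refl = ℚ.*-identityʳ a
    weight≤ : ∀ u c → 𝟙 (S? u) * M u c ≤ 𝟙 (T? c) * M u c
    weight≤ u c with S? u | 0ℚ ℚ.<? M u c
    ... | no _  | _       = ℚ.≤-trans (ℚ.≤-reflexive (ℚ.*-zeroˡ (M u c))) (*-nonNeg (0≤𝟙 (T? c)) (nonNeg u c))
    ... | yes s | yes pos = ℚ.≤-reflexive (cong (_* M u c) (≡.sym (𝟙-yes (T? c) (S→T u c s pos))))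
    ... | yes _ | no ¬pos = ℚ.≤-trans (ℚ.≤-reflexive (trans (ℚ.*-identityˡ (M u c)) Muc≡0))
                                       (*-nonNeg (0≤𝟙 (T? c)) (nonNeg u c))
      where
      Muc≡0 : M u c ≡ 0ℚ
      Muc≡0 = ℚ.≤-antisym (ℚ.≮⇒≥ ¬pos) (nonNeg u c)

  support-notDeficient : ∀ {S : Pred (Fin n) 0ℓ} → Decidable S → ∀ j → ¬ Deficient (λ u c → 0ℚ < M u c) S j
  support-notDeficient {S} S? j (Sj , S→S∖j) = ℚ.<-irrefl refl (begin-strict
    card T?            <⟨ p<1+p (card T?) ⟩
    1ℚ + card T?       ≡⟨ ≡.sym card-S ⟩
    card S?            ≤⟨ support⊆⇒card≤card S? T? S→S∖j ⟩
    card T?            ∎)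
    where
    open ℚ.≤-Reasoning
    T? : Decidable (λ c → S c × c ≢ j)
    T? c = S? c ×-dec ¬? (c ≟ j)
    split : ∀ u → 𝟙 (S? u) ≡ 𝟙 (u ≟ j) + 𝟙 (T? u)
    split u with S? u | u ≟ j
    ... | yes _  | yes refl = ≡.sym (ℚ.+-identityʳ 1ℚ)
    ... | no ¬Sj | yes refl = ⊥-elim (¬Sj Sj)
    ... | yes _  | no _     = ≡.sym (ℚ.+-identityˡ 1ℚ)
    ... | no _   | no _     = ≡.sym (ℚ.+-identityˡ 0ℚ)
    card-S : card S? ≡ 1ℚ + card T?
    card-S = trans (sumFin-cong n split)
                   (trans (sumFin-distrib-+ n _ _) (cong (_+ card T?) (card-singleton (_≟ j) refl id)))

module _ {n : ℕ} (i j : Fin n) where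

  transpose-appˡ : Perm.transpose i j ⟨$⟩ʳ i ≡ j
  transpose-appˡ rewrite dec-true (i ≟ i) refl = refl

  transpose-appʳ : Perm.transpose i j ⟨$⟩ʳ j ≡ i
  transpose-appʳ with j ≟ i
  ... | yes j≡i = j≡i
  ... | no _ rewrite dec-true (j ≟ j) refl = refl

  transpose-app-other : ∀ {k} → k ≢ i → k ≢ j → Perm.transpose i j ⟨$⟩ʳ k ≡ k
  transpose-app-other {k} k≢i k≢j rewrite dec-false (k ≟ i) k≢i | dec-false (k ≟ j) k≢j = refl

-- Hall's condition is assumed for every relabelling π of the columns, because the search names
-- each column after the row currently matched to it.
module PerfectMatching {n : ℕ} {_~_ : Fin n → Fin n → Set} (_~?_ : ∀ u c → Dec (u ~ c))
  (hall : ∀ (π : Permutation′ n) {S : Pred (Fin n) 0ℓ} → Decidable S → ∀ j →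
          ¬ Deficient (λ u c → u ~ (π ⟨$⟩ʳ c)) S j)
  where

  Matches : Permutation′ n → Pred (Fin n) 0ℓ → Set
  Matches π A = ∀ i → A i → i ~ (π ⟨$⟩ʳ i)

  module Augment (π : Permutation′ n) {A : Pred (Fin n) 0ℓ} (A? : Decidable A) (π-matches-A : Matches π A)
                 (j : Fin n) where

    open import Data.List.Membership.DecPropositional (_≟_ {n}) using (_∈?_)

    _⇝_ : Fin n → Fin n → Set
    u ⇝ k = u ~ (π ⟨$⟩ʳ k)

    data Path : Fin n → Set where
      [j] : Path j
      _▷_ : ∀ {u k} → Path u → u ⇝ k → Path k

    _∈ₚ_ : ∀ {u} → Fin n → Path u → Set
    v ∈ₚ [j]                 = v ≡ j
    v ∈ₚ (_▷_ {k = k} P _) = v ≡ k ⊎ v ∈ₚ P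

    _∈ₚ?_ : ∀ {u} v (P : Path u) → Dec (v ∈ₚ P)
    v ∈ₚ? [j]                 = v ≟ j
    v ∈ₚ? (_▷_ {k = k} P _) = (v ≟ k) ⊎-dec (v ∈ₚ? P)

    j∈ₚ : ∀ {u} (P : Path u) → j ∈ₚ P
    j∈ₚ [j]     = refl
    j∈ₚ (P ▷ _) = inj₂ (j∈ₚ P)

    end∈ₚ : ∀ {u} (P : Path u) → u ∈ₚ P
    end∈ₚ [j]     = refl
    end∈ₚ (P ▷ _) = inj₁ refl

    Simple : ∀ {u} → Path u → Set
    Simple [j]                 = ⊤
    Simple (_▷_ {k = k} P _) = ¬ k ∈ₚ P × Simple P

    -- The cycle sending each vertex of the path to its successor and the endpoint back to j.
    rotate : ∀ {u} → Path u → Permutation′ n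
    rotate [j]                   = Perm.id
    rotate (_▷_ {u} {k} P _) = Perm.transpose u k ∘ₚ rotate P

    rotate-end : ∀ {u} (P : Path u) → rotate P ⟨$⟩ʳ u ≡ j
    rotate-end [j]                   = refl
    rotate-end (_▷_ {u} {k} P _) = trans (cong (rotate P ⟨$⟩ʳ_) (transpose-appʳ u k)) (rotate-end P)

    rotate-off : ∀ {u v} (P : Path u) → ¬ v ∈ₚ P → rotate P ⟨$⟩ʳ v ≡ v
    rotate-off [j]                       v∉P = refl
    rotate-off {v = v} (_▷_ {u} {k} P _) v∉P =
      trans (cong (rotate P ⟨$⟩ʳ_) (transpose-app-other u k v≢u (v∉P ∘ inj₁))) (rotate-off P (v∉P ∘ inj₂))
      where
      v≢u : v ≢ u
      v≢u refl = v∉P (inj₂ (end∈ₚ P))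

    rotate-step : ∀ {u v} (P : Path u) → Simple P → v ∈ₚ P → v ≢ u → v ⇝ (rotate P ⟨$⟩ʳ v)
    rotate-step [j]     _ v≡j        v≢j = ⊥-elim (v≢j v≡j)
    rotate-step (P ▷ _) _ (inj₁ v≡k) v≢k = ⊥-elim (v≢k v≡k)
    rotate-step {v = v} (_▷_ {u} {k} P u⇝k) (k∉P , simple) (inj₂ v∈P) v≢k with u ≟ v
    ... | yes refl = ≡.subst (v ⇝_) (≡.sym u↦k) u⇝k
      where
      u↦k : rotate P ⟨$⟩ʳ (Perm.transpose u k ⟨$⟩ʳ u) ≡ k
      u↦k = trans (cong (rotate P ⟨$⟩ʳ_) (transpose-appˡ u k)) (rotate-off P k∉P)
    ... | no u≢v   = ≡.subst (v ⇝_) (≡.sym (cong (rotate P ⟨$⟩ʳ_) (transpose-app-other u k (≢-sym u≢v) v≢k)))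
                       (rotate-step P simple v∈P (≢-sym u≢v))

    Augmented : Set
    Augmented = Σ (Permutation′ n) λ π′ → Matches π′ (λ i → A i ⊎ i ≡ j)

    augmentAlong : ∀ {u} (P : Path u) → Simple P → u ⇝ j ⊎ (¬ A u × u ≢ j) → Augmented
    augmentAlong {u} P simple end = rotate P ∘ₚ π , matches
      where
      endpoint : u ⇝ j ⊎ (¬ A u × u ≢ j) → A u ⊎ u ≡ j → u ⇝ (rotate P ⟨$⟩ʳ u)
      endpoint (inj₁ u⇝j)        _          = ≡.subst (u ⇝_) (≡.sym (rotate-end P)) u⇝j
      endpoint (inj₂ (¬Au , _))  (inj₁ Au)  = ⊥-elim (¬Au Au)
      endpoint (inj₂ (_ , u≢j))  (inj₂ u≡j) = ⊥-elim (u≢j u≡j)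

      offPath : ∀ {i} → A i ⊎ i ≡ j → ¬ i ∈ₚ P → i ⇝ (rotate P ⟨$⟩ʳ i)
      offPath {i} (inj₁ Ai) i∉P = ≡.subst (i ⇝_) (≡.sym (rotate-off P i∉P)) (π-matches-A i Ai)
      offPath (inj₂ refl)   j∉P = ⊥-elim (j∉P (j∈ₚ P))

      matches : Matches (rotate P ∘ₚ π) (λ i → A i ⊎ i ≡ j)
      matches i A⁺i with i ∈ₚ? P | i ≟ u
      ... | yes i∈P | no i≢u = rotate-step P simple i∈P i≢u
      ... | yes _   | yes refl = endpoint end A⁺i
      ... | no i∉P  | _        = offPath A⁺i i∉P

    -- A row of A counts as visited once the search has removed it from R.
    Visited : List (Fin n) → Pred (Fin n) 0ℓ
    Visited R t = t ≡ j ⊎ (A t × t ∉ R)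

    visited? : ∀ R → Decidable (Visited R)
    visited? R t = (t ≟ j) ⊎-dec (A? t ×-dec ¬? (t ∈? R))

    record Reached (R : List (Fin n)) (t : Fin n) : Set where
      constructor reached
      field
        path    : Path t
        simple  : Simple path
        visited : ∀ v → v ∈ₚ path → Visited R v

    Explored : List (Fin n) → Set
    Explored R = ∀ t → Visited R t → Reached R t

    _≢?_ : ∀ (t k : Fin n) → Dec (t ≢ k)
    t ≢? k = ¬? (t ≟ k)

    without : Fin n → List (Fin n) → List (Fin n)
    without k = filter (_≢? k)

    without-shorter : ∀ {k R} → k ∈ R → length (without k R) ℕ.< length R
    without-shorter {k} {R} k∈R = filter-notAll (_≢? k) R (Any.map (λ k≡t t≢k → t≢k (≡.sym k≡t)) k∈R)

    visited-without : ∀ {k R t} → Visited R t → Visited (without k R) t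
    visited-without     (inj₁ t≡j)        = inj₁ t≡j
    visited-without {k} (inj₂ (At , t∉R)) = inj₂ (At , t∉R ∘ proj₁ ∘ ∈-filter⁻ (_≢? k))

    visited-without⁻ : ∀ {k R t} → Visited (without k R) t → Visited R t ⊎ t ≡ k
    visited-without⁻ (inj₁ t≡j) = inj₁ (inj₁ t≡j)
    visited-without⁻ {k} {R} {t} (inj₂ (At , t∉R′)) with t ≟ k
    ... | yes t≡k = inj₂ t≡k
    ... | no t≢k  = inj₁ (inj₂ (At , λ t∈R → t∉R′ (∈-filter⁺ (_≢? k) t∈R t≢k)))

    explore : ∀ {R u k} → Explored R → Visited R u → u ⇝ k → ¬ Visited R k → A k → Explored (without k R)
    explore {R} {u} {k} explored u-vis u⇝k k-unvis Ak t t-vis with visited-without⁻ t-vis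
    ... | inj₁ t-vis′ = let reached P simple P-vis = explored t t-vis′ in
                        reached P simple (λ v v∈P → visited-without (P-vis v v∈P))
    ... | inj₂ refl   = reached (P ▷ u⇝k) ((k-unvis ∘ P-vis k) , simple) P▷k-vis
      where
      open Reached (explored u u-vis) renaming (path to P; visited to P-vis)
      P▷k-vis : ∀ v → v ∈ₚ (P ▷ u⇝k) → Visited (without k R) v
      P▷k-vis v (inj₁ refl) = inj₂ (Ak , λ k∈R′ → proj₂ (∈-filter⁻ (_≢? k) {xs = R} k∈R′) refl)
      P▷k-vis v (inj₂ v∈P)  = visited-without (P-vis v v∈P)

    Exit : List (Fin n) → Set
    Exit R = ∃ λ u → ∃ λ k → Visited R u × u ⇝ k × (k ≡ j ⊎ ¬ Visited R k)

    exit? : ∀ R → Dec (Exit R)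
    exit? R = any? λ u → any? λ k →
      visited? R u ×-dec (u ~? (π ⟨$⟩ʳ k)) ×-dec ((k ≟ j) ⊎-dec ¬? (visited? R k))

    noExit⇒deficient : ∀ R → ¬ Exit R → Deficient _⇝_ (Visited R) j
    noExit⇒deficient R noExit = inj₁ refl , λ u c u-vis u⇝c →
      decidable-stable (visited? R c) (λ c-unvis → noExit (u , c , u-vis , u⇝c , inj₂ c-unvis)) ,
      (λ c≡j → noExit (u , c , u-vis , u⇝c , inj₁ c≡j))

    search : ∀ R → Acc ℕ._<_ (length R) → Explored R → Augmented
    search R (acc shorter) explored with exit? R
    ... | no noExit = ⊥-elim (hall π (visited? R) j (noExit⇒deficient R noExit))
    ... | yes (u , k , u-vis , u⇝k , k-new) with explored u u-vis | k-new
    ...   | reached P simple _     | inj₁ refl    = augmentAlong P simple (inj₁ u⇝k)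
    ...   | reached P simple P-vis | inj₂ k-unvis with A? k
    ...     | no ¬Ak = augmentAlong (P ▷ u⇝k) ((k-unvis ∘ P-vis k) , simple) (inj₂ (¬Ak , k-unvis ∘ inj₁))
    ...     | yes Ak = search (without k R) (shorter (without-shorter k∈R))
                              (explore explored u-vis u⇝k k-unvis Ak)
      where
      k∈R : k ∈ R
      k∈R = decidable-stable (k ∈? R) (λ k∉R → k-unvis (inj₂ (Ak , k∉R)))

    augment : Augmented
    augment = search (allFin n) (<-wellFounded _) explored₀
      where
      explored₀ : Explored (allFin n)
      explored₀ t (inj₁ refl)     = reached [j] tt (λ _ → inj₁)
      explored₀ t (inj₂ (_ , t∉)) = ⊥-elim (t∉ (∈-allFin t))

  matchFirst : ∀ m → m ℕ.≤ n → Σ (Permutation′ n) λ π → Matches π (λ i → toℕ i ℕ.< m)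
  matchFirst ℕ.zero    _   = Perm.id , λ i ()
  matchFirst (ℕ.suc m) m<n = extend (matchFirst m (ℕ.<⇒≤ m<n))
    where
    j : Fin n
    j = fromℕ< m<n
    below-or-j : ∀ {i} → toℕ i ℕ.< ℕ.suc m → toℕ i ℕ.< m ⊎ i ≡ j
    below-or-j i<1+m with ℕ.m≤n⇒m<n∨m≡n (ℕ.s≤s⁻¹ i<1+m)
    ... | inj₁ i<m = inj₁ i<m
    ... | inj₂ i≡m = inj₂ (toℕ-injective (trans i≡m (≡.sym (toℕ-fromℕ< m<n))))
    extend : Σ (Permutation′ n) (λ π → Matches π (λ i → toℕ i ℕ.< m)) →
             Σ (Permutation′ n) (λ π → Matches π (λ i → toℕ i ℕ.< ℕ.suc m))
    extend (π , π-ok) =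
      let π′ , π′-ok = Augment.augment π (λ i → toℕ i ℕ.<? m) π-ok j
      in  π′ , λ i i<1+m → π′-ok i (below-or-j i<1+m)

  perfectMatching : Σ (Permutation′ n) λ σ → ∀ i → i ~ (σ ⟨$⟩ʳ i)
  perfectMatching = let σ , σ-ok = matchFirst n ℕ.≤-refl in σ , λ i → σ-ok i (toℕ<n i)

positiveDiagonal : ∀ {n} {M : Fin n → Fin n → ℚ} → DoublyStochastic M →
  Σ (Permutation′ n) λ σ → ∀ i → 0ℚ < M i (σ ⟨$⟩ʳ i)
positiveDiagonal {M = M} ds = PerfectMatching.perfectMatching (λ u c → 0ℚ ℚ.<? M u c)
  (λ π S? → support-notDeficient (permuteColumns ds π) S?)

inD̃⇒doublyStochastic : ∀ {n} {x : Point n} → InD̃ x → DoublyStochastic x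
inD̃⇒doublyStochastic (rowSum , colSum , bounds) = record
  { nonNeg = λ i v → proj₁ (bounds i v)
  ; rowSum = rowSum
  ; colSum = colSum
  }

permutationMatrix : ∀ {n} → Permutation′ n → Point n
permutationMatrix σ i v = 𝟙 (σ ⟨$⟩ʳ i ≟ v)

permutationMatrix∈D̃ : ∀ {n} (σ : Permutation′ n) → InD̃ (permutationMatrix σ)
permutationMatrix∈D̃ {n} σ = rowSum , colSum , λ i v → 0≤𝟙 (σ ⟨$⟩ʳ i ≟ v) , 𝟙≤1 (σ ⟨$⟩ʳ i ≟ v)
  where
  rowSum : ∀ i → sumFin n (λ v → 𝟙 (σ ⟨$⟩ʳ i ≟ v)) ≡ 1ℚ
  rowSum i = card-singleton (σ ⟨$⟩ʳ i ≟_) refl ≡.sym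
  colSum : ∀ v → sumFin n (λ i → 𝟙 (σ ⟨$⟩ʳ i ≟ v)) ≡ 1ℚ
  colSum v = trans (sumFin-permute n (λ w → 𝟙 (w ≟ v)) σ) (card-singleton (_≟ v) refl id)

module _ {n : ℕ} (G : SimpleGraph n) where

  F-term : Point n → Fin n → Fin n → Fin n → ℚ
  F-term x i v u = if adj G v u then 0ℚ else x i v * x (next i) u

  F≡0⇒adjacent : ∀ {x : Point n} → (∀ i v → 0ℚ ≤ x i v) → F G x ≡ 0ℚ →
    ∀ i v u → 0ℚ < x i v → 0ℚ < x (next i) u → adj G v u ≡ true
  F≡0⇒adjacent {x} x≥0 F≡0 i v u xiv>0 xi′u>0 = adjacent (adj G v u) (term≡0 i v u) xiv>0 xi′u>0
    where
    term≥0 : ∀ i v u → 0ℚ ≤ F-term x i v u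
    term≥0 i v u with adj G v u
    ... | true  = ℚ.≤-refl
    ... | false = *-nonNeg (x≥0 i v) (x≥0 (next i) u)
    layer≡0 : ∀ i → sumFin n (λ v → sumFin n (F-term x i v)) ≡ 0ℚ
    layer≡0 = sumFin≡0⇒term≡0 n (λ i → sumFin-nonNeg n (λ v → sumFin-nonNeg n (term≥0 i v))) F≡0
    row≡0 : ∀ i v → sumFin n (F-term x i v) ≡ 0ℚ
    row≡0 i = sumFin≡0⇒term≡0 n (λ v → sumFin-nonNeg n (term≥0 i v)) (layer≡0 i)
    term≡0 : ∀ i v u → F-term x i v u ≡ 0ℚ
    term≡0 i v = sumFin≡0⇒term≡0 n (term≥0 i v) (row≡0 i v)
    adjacent : ∀ b {p q} → (if b then 0ℚ else p * q) ≡ 0ℚ → 0ℚ < p → 0ℚ < q → b ≡ true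
    adjacent true  _     _   _   = refl
    adjacent false pq≡0 p>0 q>0 = ⊥-elim (ℚ.<-irrefl (≡.sym pq≡0) (*-pos p>0 q>0))

  F-permutationMatrix : (σ : Permutation′ n) → (∀ i → adj G (σ ⟨$⟩ʳ i) (σ ⟨$⟩ʳ next i) ≡ true) →
    F G (permutationMatrix σ) ≡ 0ℚ
  F-permutationMatrix σ σ-adj =
    sumFin-zero n λ i → sumFin-zero n λ v → sumFin-zero n λ u → term≡0 i v u
    where
    vanishes : ∀ b {p} → p ≡ 0ℚ → (if b then 0ℚ else p) ≡ 0ℚ
    vanishes true  _   = refl
    vanishes false p≡0 = p≡0
    term≡0 : ∀ i v u → F-term (permutationMatrix σ) i v u ≡ 0ℚ
    term≡0 i v u with σ ⟨$⟩ʳ i ≟ v | σ ⟨$⟩ʳ next i ≟ u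
    ... | yes refl | yes refl rewrite σ-adj i = refl
    ... | no _     | u?       = vanishes (adj G v u) (ℚ.*-zeroˡ (𝟙 u?))
    ... | yes _    | no _     = vanishes (adj G v u) (ℚ.*-zeroʳ 1ℚ)

proposition1 : (n : ℕ) (G : SimpleGraph n) (F̃ : ℚ) → IsMinF G F̃ →
    (F̃ ≡ 0ℚ → HamiltonianCircuit G) × (1/n! n ≤ F̃ → ¬ HamiltonianCircuit G)
proposition1 n G F̃ ((x , x∈D̃ , Fx≡F̃) , F̃-minimal) = hamiltonian , notHamiltonian
  where
  x-stochastic : DoublyStochastic x
  x-stochastic = inD̃⇒doublyStochastic x∈D̃

  hamiltonian : F̃ ≡ 0ℚ → HamiltonianCircuit G
  hamiltonian F̃≡0 =
    let σ , σ-pos = positiveDiagonal x-stochastic in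
    σ , λ i → F≡0⇒adjacent G (DoublyStochastic.nonNeg x-stochastic) (trans Fx≡F̃ F̃≡0)
                i _ _ (σ-pos i) (σ-pos (next i))

  notHamiltonian : 1/n! n ≤ F̃ → ¬ HamiltonianCircuit G
  notHamiltonian 1/n!≤F̃ (σ , σ-adj) = ℚ.<-irrefl refl (begin-strict
    0ℚ                          <⟨ 1/n!-pos n ⟩
    1/n! n                      ≤⟨ 1/n!≤F̃ ⟩
    F̃                           ≤⟨ F̃-minimal _ (permutationMatrix∈D̃ σ) ⟩
    F G (permutationMatrix σ)   ≡⟨ F-permutationMatrix G σ σ-adj ⟩
    0ℚ                          ∎)
    where open ℚ.≤-Reasoning
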